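{- For every integer $t\geq 2$, every (finite, simple) graph with no dominating $K_t$-model is $2^{t-2}$-colourable.
   Context: A dominating $K_t$-model in a graph $G$ is a sequence $(T_1,\dots,T_t)$ of pairwise disjoint non-empty connected subgraphs of $G$ such that for all $1\le i<j\le t$, every vertex of $T_j$ has a neighbour in $T_i$. -}

module Defs where

open import Data.Nat using (ℕ)
open import Data.Fin using (Fin; _<_)
open import Data.Fin.Subset using (Subset; _∈_)
open import Data.Product using (Σ; ∃; _×_)
open import Relation.Nullary using (¬_; Dec)
open import Relation.Binary.PropositionalEquality using (_≡_; _≢_)

record SimpleGraph (n : ℕ) : Set₁ where
  field
    Adj     : Fin n → Fin n → Set
    adj?    : ∀ u v → Dec (Adj u v)
    symAdj  : ∀ {u v} → Adj u v → Adj v u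
    irrefl  : ∀ {u} → ¬ Adj u u
open SimpleGraph public

data WalkIn {n : ℕ} (G : SimpleGraph n) (S : Subset n) : Fin n → Fin n → Set where
  here : ∀ {u} → u ∈ S → WalkIn G S u u
  step : ∀ {u w v} → u ∈ S → Adj G u w → WalkIn G S w v → WalkIn G S u v

NonEmptyConnected : {n : ℕ} → SimpleGraph n → Subset n → Set
NonEmptyConnected G S =
  (∃ λ v → v ∈ S) × (∀ u v → u ∈ S → v ∈ S → WalkIn G S u v)

record DominatingModel {n : ℕ} (G : SimpleGraph n) (t : ℕ) : Set where
  field
    T         : Fin t → Subset n
    connected : ∀ i → NonEmptyConnected G (T i)
    disjoint  : ∀ i j → i ≢ j → ∀ v → v ∈ T i → ¬ (v ∈ T j)
    dominates : ∀ i j → i < j → ∀ v → v ∈ T j → ∃ λ u → u ∈ T i × Adj G v u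

Colouring : {n : ℕ} → SimpleGraph n → ℕ → Set
Colouring {n} G k = Σ (Fin n → Fin k) λ c → ∀ u v → Adj G u v → c u ≢ c v

{-# OPTIONS --safe #-}
-- Grow a breadth-first search from a root of each component in turn.
-- Each new layer N is dominated by the connected ball X explored before it, so a
-- dominating K_{t-1}-model of G[N] would extend, with X in front, to a dominating
-- K_t-model of G. Hence every layer is 2^{t-3}-colourable, and since edges only join
-- vertices of the same or of consecutive layers, adding the parity of the layer as an
-- extra bit gives a proper 2^{t-2}-colouring of G.
module Submission where

open import Defs
open import Data.Nat using (ℕ; _≤_; _^_; _∸_)
open import Relation.Nullary using (¬_)

open import Data.Bool using (Bool; false; not)
open import Data.Bool.Properties using (not-¬)
open import Data.Empty using (⊥-elim)
open import Data.Fin using (Fin; zero; suc; _<_; fromℕ<)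
open import Data.Fin.Properties using (any?; 2↔Bool; *↔×)
open import Data.Fin.Subset
  using (Subset; _∈_; _∉_; _⊆_; _⊃_; _∪_; ⁅_⁆; Nonempty; Empty) renaming (⊥ to ∅)
open import Data.Fin.Subset.Properties
  using (_∈?_; nonempty?; ∉⊥; x∈⁅x⁆; x∈⁅y⁆⇒x≡y; p⊆p∪q; q⊆p∪q; x∈p∪q⁻)
open import Data.Fin.Subset.Induction using (Acc; acc; ⊃-wellFounded)
open import Data.Nat.Base using (zero; suc; _*_; z≤n; s≤s)
open import Data.Nat.Properties using (m^n>0)
open import Data.Product using (Σ; ∃; _×_; _,_; proj₁; proj₂)
open import Data.Product.Function.NonDependent.Propositional using (_×-↔_)
open import Data.Sum using (_⊎_; inj₁; inj₂; [_,_]′)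
open import Data.Vec using (tabulate)
open import Data.Vec.Properties using (lookup∘tabulate; lookup⇒[]=; []=⇒lookup)
open import Function using (_∘_; _↣_; Injection)
open import Function.Properties.Inverse using (↔-refl; ↔-sym; ↔-trans; ↔⇒↣)
open import Relation.Binary.PropositionalEquality using (_≡_; _≢_; refl; sym; trans; cong)
open import Relation.Nullary using (yes; no; does)
open import Relation.Nullary.Decidable using (dec-true; decidable-stable; _×-dec_; ¬?)
open import Relation.Unary using (Pred; Decidable)

module _ {n : ℕ} {ℓ} {P : Pred (Fin n) ℓ} (P? : Decidable P) where

  select : Subset n
  select = tabulate (does ∘ P?)

  ∈-select⁺ : ∀ {x} → P x → x ∈ select
  ∈-select⁺ {x} px =
    lookup⇒[]= x select (trans (lookup∘tabulate (does ∘ P?) x) (dec-true (P? x) px))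

  ∈-select⁻ : ∀ {x} → x ∈ select → P x
  ∈-select⁻ {x} x∈ with P? x | trans (sym (lookup∘tabulate (does ∘ P?) x)) ([]=⇒lookup x∈)
  ... | yes px | _  = px
  ... | no  _  | ()

x∈p∪q∧x∉p⇒x∈q : ∀ {n} {p q : Subset n} {x} → x ∈ p ∪ q → x ∉ p → x ∈ q
x∈p∪q∧x∉p⇒x∈q {p = p} {q} x∈ x∉p with x∈p∪q⁻ p q x∈
... | inj₁ x∈p = ⊥-elim (x∉p x∈p)
... | inj₂ x∈q = x∈q

module _ {n : ℕ} where

  Connected : SimpleGraph n → Subset n → Set
  Connected G S = ∀ u v → u ∈ S → v ∈ S → WalkIn G S u v

  Dominates : SimpleGraph n → Subset n → Subset n → Set
  Dominates G A B = ∀ v → v ∈ B → ∃ λ u → u ∈ A × Adj G v u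

  Proper : {C : Set} → SimpleGraph n → (Fin n → C) → Set
  Proper G c = ∀ u v → Adj G u v → c u ≢ c v

  -- G[N], keeping the vertices outside N as isolated vertices so that it lives on Fin n.
  Induced : SimpleGraph n → Subset n → SimpleGraph n
  Induced G N = record
    { Adj    = λ u v → u ∈ N × v ∈ N × Adj G u v
    ; adj?   = λ u v → (u ∈? N) ×-dec (v ∈? N) ×-dec adj? G u v
    ; symAdj = λ { (u∈ , v∈ , uv) → v∈ , u∈ , symAdj G uv }
    ; irrefl = λ { (_ , _ , uu) → irrefl G uu }
    }

  mapWalk : ∀ {G H : SimpleGraph n} {S S′ : Subset n} →
            (∀ {u v} → Adj H u v → Adj G u v) → S ⊆ S′ →
            ∀ {u v} → WalkIn H S u v → WalkIn G S′ u v
  mapWalk f g (here u∈)       = here (g u∈)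
  mapWalk f g (step u∈ uw wv) = step (g u∈) (f uw) (mapWalk f g wv)

  _++ᵂ_ : ∀ {G : SimpleGraph n} {S : Subset n} {u w v} →
          WalkIn G S u w → WalkIn G S w v → WalkIn G S u v
  here _          ++ᵂ wv = wv
  step u∈ uw′ w′w ++ᵂ wv = step u∈ uw′ (w′w ++ᵂ wv)

  walk-start-∈ : ∀ {G : SimpleGraph n} {N S : Subset n} {u v} →
                 WalkIn (Induced G N) S u v → v ∈ N → u ∈ N
  walk-start-∈ (here _)              v∈N = v∈N
  walk-start-∈ (step _ (u∈N , _) _) _   = u∈N

  Connected-⁅⁆ : ∀ {G : SimpleGraph n} r → Connected G ⁅ r ⁆
  Connected-⁅⁆ r u v u∈ v∈ with x∈⁅y⁆⇒x≡y r u∈ | x∈⁅y⁆⇒x≡y r v∈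
  ... | refl | refl = here u∈

  Connected-∪ : ∀ {G : SimpleGraph n} {X Y : Subset n} →
                Connected G X → Dominates G X Y → Connected G (X ∪ Y)
  Connected-∪ {G} {X} {Y} conn dom u v u∈ v∈ = through (entry u u∈) (exit v v∈)
    where
    through : (∃ λ u′ → u′ ∈ X × WalkIn G (X ∪ Y) u u′) →
              (∃ λ v′ → v′ ∈ X × WalkIn G (X ∪ Y) v′ v) → WalkIn G (X ∪ Y) u v
    through (u′ , u′∈X , uu′) (v′ , v′∈X , v′v) =
      uu′ ++ᵂ (mapWalk (λ e → e) (p⊆p∪q Y) (conn u′ v′ u′∈X v′∈X) ++ᵂ v′v)
    entry : ∀ u → u ∈ X ∪ Y → ∃ λ u′ → u′ ∈ X × WalkIn G (X ∪ Y) u u′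
    entry u u∈ with x∈p∪q⁻ X Y u∈
    ... | inj₁ u∈X = u , u∈X , here u∈
    ... | inj₂ u∈Y with dom u u∈Y
    ...   | u′ , u′∈X , uu′ = u′ , u′∈X , step u∈ uu′ (here (p⊆p∪q Y u′∈X))
    exit : ∀ v → v ∈ X ∪ Y → ∃ λ v′ → v′ ∈ X × WalkIn G (X ∪ Y) v′ v
    exit v v∈ with x∈p∪q⁻ X Y v∈
    ... | inj₁ v∈X = v , v∈X , here v∈
    ... | inj₂ v∈Y with dom v v∈Y
    ...   | v′ , v′∈X , vv′ = v′ , v′∈X , step (p⊆p∪q Y v′∈X) (symAdj G vv′) (here v∈)

module _ {n : ℕ} {G : SimpleGraph n} where

  edge⇒dominatingModel : ∀ {u v} → Adj G u v → DominatingModel G 2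
  edge⇒dominatingModel {u} {v} uv = record
    { T = T ; connected = connected ; disjoint = disjoint ; dominates = dominates }
    where
    T : Fin 2 → Subset n
    T zero       = ⁅ u ⁆
    T (suc zero) = ⁅ v ⁆
    connected : ∀ i → NonEmptyConnected G (T i)
    connected zero       = (u , x∈⁅x⁆ u) , Connected-⁅⁆ u
    connected (suc zero) = (v , x∈⁅x⁆ v) , Connected-⁅⁆ v
    u≢v : ∀ {x} → x ∈ ⁅ u ⁆ → x ∉ ⁅ v ⁆
    u≢v x∈u x∈v with x∈⁅y⁆⇒x≡y u x∈u | x∈⁅y⁆⇒x≡y v x∈v
    ... | refl | refl = irrefl G uv
    disjoint : ∀ i j → i ≢ j → ∀ x → x ∈ T i → x ∉ T j
    disjoint zero       zero       i≢j _ _   _   = i≢j refl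
    disjoint zero       (suc zero) _   _ x∈u x∈v = u≢v x∈u x∈v
    disjoint (suc zero) zero       _   _ x∈v x∈u = u≢v x∈u x∈v
    disjoint (suc zero) (suc zero) i≢j _ _   _   = i≢j refl
    dominates : ∀ i j → i < j → ∀ x → x ∈ T j → ∃ λ w → w ∈ T i × Adj G x w
    dominates zero (suc zero) _ x x∈v with x∈⁅y⁆⇒x≡y v x∈v
    ... | refl = u , x∈⁅x⁆ u , symAdj G uv
    dominates (suc zero) (suc zero) (s≤s ())

  colouring₁ : ¬ DominatingModel G 2 → Colouring G 1
  colouring₁ ¬M = (λ _ → zero) , λ _ _ uv _ → ¬M (edge⇒dominatingModel uv)

-- Two parts are needed: a vertex outside N is a connected part of a model in Induced G N.
parts-⊆ : ∀ {n} {G : SimpleGraph n} {N : Subset n} {s} →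
          (M : DominatingModel (Induced G N) (suc (suc s))) → ∀ i → DominatingModel.T M i ⊆ N
parts-⊆ {N = N} M zero {v} v∈T₀ = through (proj₁ (connected (suc zero)))
  where
  open DominatingModel M
  through : Nonempty (T (suc zero)) → v ∈ N
  through (w , w∈T₁) with dominates zero (suc zero) (s≤s z≤n) w w∈T₁
  ... | u , u∈T₀ , (_ , u∈N , _) = walk-start-∈ (proj₂ (connected zero) v u v∈T₀ u∈T₀) u∈N
parts-⊆ M (suc j) {v} v∈T with DominatingModel.dominates M zero (suc j) (s≤s z≤n) v v∈T
... | _ , _ , (v∈N , _) = v∈N

dominatingModel-cons : ∀ {n} {G : SimpleGraph n} {A N : Subset n} {s} →
  NonEmptyConnected G A → (∀ v → v ∈ N → v ∉ A) → Dominates G A N →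
  DominatingModel (Induced G N) (suc (suc s)) → DominatingModel G (suc (suc (suc s)))
dominatingModel-cons {n} {G} {A} {N} {s} connA N∩A dom M = record
  { T = T′ ; connected = connected′ ; disjoint = disjoint′ ; dominates = dominates′ }
  where
  open DominatingModel M
  T′ : Fin (suc (suc (suc s))) → Subset n
  T′ zero    = A
  T′ (suc i) = T i
  connected′ : ∀ i → NonEmptyConnected G (T′ i)
  connected′ zero    = connA
  connected′ (suc i) = proj₁ (connected i) , λ u v u∈ v∈ →
    mapWalk (λ (_ , _ , uv) → uv) (λ x∈ → x∈) (proj₂ (connected i) u v u∈ v∈)
  disjoint′ : ∀ i j → i ≢ j → ∀ v → v ∈ T′ i → v ∉ T′ j
  disjoint′ zero    zero    i≢j _ _   _   = i≢j refl
  disjoint′ zero    (suc j) _   v v∈A v∈T = N∩A v (parts-⊆ M j v∈T) v∈A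
  disjoint′ (suc i) zero    _   v v∈T v∈A = N∩A v (parts-⊆ M i v∈T) v∈A
  disjoint′ (suc i) (suc j) i≢j v       = disjoint i j (i≢j ∘ cong suc) v
  dominates′ : ∀ i j → i < j → ∀ v → v ∈ T′ j → ∃ λ u → u ∈ T′ i × Adj G v u
  dominates′ zero    (suc j) _         v v∈T = dom v (parts-⊆ M j v∈T)
  dominates′ (suc i) (suc j) (s≤s i<j) v v∈T with dominates i j i<j v v∈T
  ... | u , u∈T , (_ , _ , vu) = u , u∈T , vu

module _ {n : ℕ} {C : Set} where

  patch : Subset n → (Fin n → C) → (Fin n → C) → Fin n → C
  patch S c₁ c₂ v with v ∈? S
  ... | yes _ = c₁ v
  ... | no  _ = c₂ v

  patch-∈ : ∀ {S c₁ c₂ v} → v ∈ S → patch S c₁ c₂ v ≡ c₁ v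
  patch-∈ {S} {v = v} v∈S with v ∈? S
  ... | yes _   = refl
  ... | no  v∉S = ⊥-elim (v∉S v∈S)

  patch-proper : ∀ {G : SimpleGraph n} {S R c₁ c₂} →
    Proper (Induced G S) c₁ → Proper (Induced G R) c₂ →
    (∀ {u v} → u ∈ S → v ∈ R → v ∉ S → Adj G u v → c₁ u ≢ c₂ v) →
    Proper (Induced G (S ∪ R)) (patch S c₁ c₂)
  patch-proper {G} {S} {R} proper₁ proper₂ cross u v (u∈ , v∈ , uv)
    with u ∈? S | v ∈? S
  ... | yes u∈S | yes v∈S = proper₁ u v (u∈S , v∈S , uv)
  ... | yes u∈S | no  v∉S = cross u∈S (x∈p∪q∧x∉p⇒x∈q v∈ v∉S) v∉S uv
  ... | no  u∉S | yes v∈S = cross v∈S (x∈p∪q∧x∉p⇒x∈q u∈ u∉S) u∉S (symAdj G uv) ∘ sym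
  ... | no  u∉S | no  v∉S =
    proper₂ u v (x∈p∪q∧x∉p⇒x∈q u∈ u∉S , x∈p∪q∧x∉p⇒x∈q v∈ v∉S , uv)

module BreadthFirst {n : ℕ} (G : SimpleGraph n) {C : Set} (default : C)
  (colourLayer : ∀ {X N} → NonEmptyConnected G X → (∀ v → v ∈ N → v ∉ X) →
                 Dominates G X N → Σ (Fin n → C) (Proper (Induced G N)))
  where

  -- K, the set of vertices coloured so far, is a union of components of G together with
  -- the ball X grown from the current root; every edge leaving K starts in the last layer
  -- of X, whose colours all have first component parity.
  record Search : Set where
    field
      K X       : Subset n
      parity    : Bool
      colour    : Fin n → Bool × C
      X⊆K       : X ⊆ K
      connected : Connected G X
      proper    : Proper (Induced G K) colour
      boundary  : ∀ {u v} → u ∈ K → Adj G u v → v ∉ K → u ∈ X × proj₁ (colour u) ≡ parity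

  open Search

  start : Search
  start = record
    { K = ∅ ; X = ∅ ; parity = false ; colour = λ _ → false , default
    ; X⊆K = λ x∈ → x∈ ; connected = λ _ _ u∈ → ⊥-elim (∉⊥ u∈)
    ; proper = λ _ _ (u∈ , _) → ⊥-elim (∉⊥ u∈) ; boundary = λ u∈ → ⊥-elim (∉⊥ u∈) }

  InNextLayer : Search → Fin n → Set
  InNextLayer S v = v ∉ K S × ∃ λ u → u ∈ X S × Adj G u v

  inNextLayer? : (S : Search) → Decidable (InNextLayer S)
  inNextLayer? S v = ¬? (v ∈? K S) ×-dec any? λ u → (u ∈? X S) ×-dec adj? G u v

  nextLayer : Search → Subset n
  nextLayer S = select (inNextLayer? S)

  ∈nextLayer⁺ : ∀ S {v} → InNextLayer S v → v ∈ nextLayer S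
  ∈nextLayer⁺ S = ∈-select⁺ (inNextLayer? S)

  ∈nextLayer⁻ : ∀ S {v} → v ∈ nextLayer S → InNextLayer S v
  ∈nextLayer⁻ S = ∈-select⁻ (inNextLayer? S)

  nextLayer-dominated : ∀ S → Dominates G (X S) (nextLayer S)
  nextLayer-dominated S v v∈N with ∈nextLayer⁻ S v∈N
  ... | _ , u , u∈X , uv = u , u∈X , symAdj G uv

  K-closed : ∀ S → Empty (nextLayer S) → ∀ {u v} → u ∈ K S → Adj G u v → v ∈ K S
  K-closed S noLayer {u} {v} u∈K uv =
    decidable-stable (v ∈? K S) λ v∉K →
      noLayer (v , ∈nextLayer⁺ S (v∉K , u , proj₁ (boundary S u∈K uv v∉K) , uv))

  addLayer : (S : Search) → Nonempty (nextLayer S) → Σ Search λ S′ → K S′ ⊃ K S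
  addLayer S (w , w∈N) = S′ , (q⊆p∪q N (K S) , w , p⊆p∪q (K S) w∈N , proj₁ (∈nextLayer⁻ S w∈N))
    where
    N = nextLayer S
    dom = nextLayer-dominated S
    X-nonempty : Nonempty (X S)
    X-nonempty = proj₁ (dom w w∈N) , proj₁ (proj₂ (dom w w∈N))
    layer = colourLayer (X-nonempty , connected S)
                        (λ v v∈N v∈X → proj₁ (∈nextLayer⁻ S v∈N) (X⊆K S v∈X)) dom
    layerColour : Fin n → Bool × C
    layerColour v = not (parity S) , proj₁ layer v
    layerProper : Proper (Induced G N) layerColour
    layerProper u v uv = proj₂ layer u v uv ∘ cong proj₂
    colour′ = patch N layerColour (colour S)
    cross : ∀ {u v} → u ∈ N → v ∈ K S → v ∉ N → Adj G u v → layerColour u ≢ colour S v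
    cross u∈N v∈K _ uv eq = not-¬ (proj₂ (boundary S v∈K (symAdj G uv) u∉K)) (sym (cong proj₁ eq))
      where u∉K = proj₁ (∈nextLayer⁻ S u∈N)
    boundary′ : ∀ {u v} → u ∈ N ∪ K S → Adj G u v → v ∉ N ∪ K S →
                u ∈ X S ∪ N × proj₁ (colour′ u) ≡ not (parity S)
    boundary′ {u} {v} u∈ uv v∉ with x∈p∪q⁻ N (K S) u∈
    ... | inj₁ u∈N = q⊆p∪q (X S) N u∈N , cong proj₁ (patch-∈ u∈N)
    ... | inj₂ u∈K = ⊥-elim (v∉ (p⊆p∪q (K S) (∈nextLayer⁺ S (v∉K , u , u∈X , uv))))
      where
      v∉K = v∉ ∘ q⊆p∪q N (K S)
      u∈X = proj₁ (boundary S u∈K uv v∉K)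
    S′ : Search
    S′ = record
      { K = N ∪ K S ; X = X S ∪ N ; parity = not (parity S) ; colour = colour′
      ; X⊆K = λ {x} x∈ → [ q⊆p∪q N (K S) ∘ X⊆K S , p⊆p∪q (K S) ]′ (x∈p∪q⁻ (X S) N x∈)
      ; connected = Connected-∪ (connected S) dom
      ; proper = patch-proper {G = G} layerProper (proper S) cross
      ; boundary = boundary′ }

  -- The new root keeps the colour it already has; its bit becomes the parity.
  addRoot : (S : Search) → Empty (nextLayer S) → ∀ {r} → r ∉ K S → Σ Search λ S′ → K S′ ⊃ K S
  addRoot S noLayer {r} r∉K = S′ , (q⊆p∪q ⁅ r ⁆ (K S) , r , p⊆p∪q (K S) (x∈⁅x⁆ r) , r∉K)
    where
    r-isolated : ∀ {u v} → u ∈ K S → Adj G u v → v ∉ ⁅ r ⁆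
    r-isolated u∈K uv v∈r with x∈⁅y⁆⇒x≡y r v∈r
    ... | refl = r∉K (K-closed S noLayer u∈K uv)
    proper′ : Proper (Induced G (⁅ r ⁆ ∪ K S)) (colour S)
    proper′ u v (u∈ , v∈ , uv) with x∈p∪q⁻ ⁅ r ⁆ (K S) u∈ | x∈p∪q⁻ ⁅ r ⁆ (K S) v∈
    ... | inj₂ u∈K | inj₂ v∈K = proper S u v (u∈K , v∈K , uv)
    ... | inj₂ u∈K | inj₁ v∈r = ⊥-elim (r-isolated u∈K uv v∈r)
    ... | inj₁ u∈r | inj₂ v∈K = ⊥-elim (r-isolated v∈K (symAdj G uv) u∈r)
    ... | inj₁ u∈r | inj₁ v∈r with x∈⁅y⁆⇒x≡y r u∈r | x∈⁅y⁆⇒x≡y r v∈r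
    ...   | refl | refl = ⊥-elim (irrefl G uv)
    boundary′ : ∀ {u v} → u ∈ ⁅ r ⁆ ∪ K S → Adj G u v → v ∉ ⁅ r ⁆ ∪ K S →
                u ∈ ⁅ r ⁆ × proj₁ (colour S u) ≡ proj₁ (colour S r)
    boundary′ u∈ uv v∉ with x∈p∪q⁻ ⁅ r ⁆ (K S) u∈
    ... | inj₂ u∈K = ⊥-elim (v∉ (q⊆p∪q ⁅ r ⁆ (K S) (K-closed S noLayer u∈K uv)))
    ... | inj₁ u∈r with x∈⁅y⁆⇒x≡y r u∈r
    ...   | refl = u∈r , refl
    S′ : Search
    S′ = record
      { K = ⁅ r ⁆ ∪ K S ; X = ⁅ r ⁆ ; parity = proj₁ (colour S r) ; colour = colour S
      ; X⊆K = p⊆p∪q (K S) ; connected = Connected-⁅⁆ r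
      ; proper = proper′ ; boundary = boundary′ }

  extend : (S : Search) → (Σ Search λ S′ → K S′ ⊃ K S) ⊎ (∀ v → v ∈ K S)
  extend S with nonempty? (nextLayer S) | any? (λ r → ¬? (r ∈? K S))
  ... | yes layer   | _              = inj₁ (addLayer S layer)
  ... | no  noLayer | yes (r , r∉K)  = inj₁ (addRoot S noLayer r∉K)
  ... | no  _       | no  allCovered =
    inj₂ λ v → decidable-stable (v ∈? K S) λ v∉K → allCovered (v , v∉K)

  run : (S : Search) → Acc _⊃_ (K S) → Σ (Fin n → Bool × C) (Proper G)
  run S (acc more) with extend S
  ... | inj₁ (S′ , grown) = run S′ (more grown)
  ... | inj₂ covered      = colour S , λ u v uv → proper S u v (covered u , covered v , uv)

  colouring : Σ (Fin n → Bool × C) (Proper G)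
  colouring = run start (⊃-wellFounded (K start))

parityColours : ∀ {k} → (Bool × Fin k) ↣ Fin (2 * k)
parityColours = ↔⇒↣ (↔-trans (↔-sym 2↔Bool ×-↔ ↔-refl) (↔-sym *↔×))

colouring-↣ : ∀ {n} {G : SimpleGraph n} {A : Set} {k} →
              A ↣ Fin k → Σ (Fin n → A) (Proper G) → Colouring G k
colouring-↣ f (c , proper) = Injection.to f ∘ c , λ u v uv → proper u v uv ∘ Injection.injective f

colouring : ∀ s {n} (G : SimpleGraph n) → ¬ DominatingModel G (suc (suc s)) → Colouring G (2 ^ s)
colouring zero    G ¬M = colouring₁ ¬M
colouring (suc s) G ¬M = colouring-↣ {G = G} parityColours
  (BreadthFirst.colouring G (fromℕ< (m^n>0 2 s)) λ {N = N} connX N∩X dom →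
     colouring s (Induced G N) (¬M ∘ dominatingModel-cons connX N∩X dom))

theorem21 : (t : ℕ) → 2 ≤ t → (n : ℕ) → (G : SimpleGraph n) →
    ¬ DominatingModel G t → Colouring G (2 ^ (t ∸ 2))
theorem21 (suc (suc s)) _       _ G ¬M = colouring s G ¬M
theorem21 (suc zero)    (s≤s ())
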